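{- Let $\Phi$ be a logic program, $n$ a closed first-order proof term in normal form and $A$ an atomic formula. If $n:\ \Rightarrow A[\llbracket n\rrbracket_\emptyset]$ is derivable given axioms $F(\Phi)$, then $F(\Phi)\vdash\{A[\llbracket n\rrbracket_\emptyset]\}\leadsto^*\emptyset$.
   Context: Syntax: first-order terms; atomic formulas $P(t_1,\dots,t_n)$; Horn formulas $[\forall \underline{x}].\ A_1,\dots,A_n \Rightarrow A$. Proof terms $p,e ::= \kappa \mid a \mid \lambda a.e \mid e\ e'$; first-order proof terms are built from proof-term variables and constants by application. A logic program is a list of closed Horn formulas labelled by distinct proof-term constants $\kappa$. Typing given axioms $\Psi$: (axiom) $\kappa:\forall\underline{x}.F$ if in $\Psi$; (gen) $e:F\Rightarrow e:\forall\underline{x}.F$; (inst) $e:\forall\underline{x}.F\Rightarrow e:[\underline{t}/\underline{x}]F$; (cut) from $e_1:\underline{A}\Rightarrow D$, $e_2:\underline{B},D\Rightarrow C$ infer $\lambda\underline{a}.\lambda\underline{b}.(e_2\ \underline{b})(e_1\ \underline{a}):\underline{A},\underline{B}\Rightarrow C$. LP-Unif reduction: $\Psi\vdash\{A_1,\dots,A_i,\dots,A_n\}\leadsto\{\gamma A_1,\dots,\gamma B_1,\dots,\gamma B_m,\dots,\gamma A_n\}$ if $\kappa:\forall\underline{x}.B_1,\dots,B_m\Rightarrow C\in\Psi$ (variables renamed apart) and $\gamma$ is a most general unifier of $C$ and $A_i$; $\leadsto^*$ is the reflexive–transitive closure. Representation: $\llbracket a\rrbracket_\phi=\phi(a)$,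 $\llbracket\kappa\ p_1\cdots p_n\rrbracket_\phi=f_\kappa(\llbracket p_1\rrbracket_\phi,\dots,\llbracket p_n\rrbracket_\phi)$ with $f_\kappa$ a function symbol associated with $\kappa$; $\emptyset$ is the empty map. $A[t']$ for $A\equiv P(t_1,\dots,t_n)$ denotes $P(t_1,\dots,t_n,t')$. $F(\Phi)$ replaces each axiom $\kappa:\forall\underline{x}.A_1,\dots,A_m\Rightarrow B$ of $\Phi$ by $\kappa:\forall\underline{x}.\forall\underline{y}.A_1[y_1],\dots,A_m[y_m]\Rightarrow B[f_\kappa(y_1,\dots,y_m)]$ with fresh distinct variables $y_i$. -}

module Defs where

open import Data.Nat using (ℕ; zero; suc; _<ᵇ_; _≡ᵇ_; pred)
open import Data.Bool using (Bool; true; false; if_then_else_)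
open import Data.List using (List; []; _∷_; _++_; map; length; zipWith; replicate)
open import Data.List.Membership.Propositional using (_∈_; _∉_)
open import Data.List.Relation.Unary.All using (All)
open import Data.List.Relation.Unary.Unique.Propositional using (Unique)
open import Data.List.Relation.Binary.Pointwise using (Pointwise)
open import Data.Product using (Σ; ∃; ∃-syntax; _×_; _,_; proj₁; proj₂)
open import Relation.Binary.PropositionalEquality using (_≡_)
open import Relation.Binary.Construct.Closure.Equivalence using (EqClosure)
open import Relation.Binary.Construct.Closure.ReflexiveTransitive using (Star)
open import Function.Definitions using (Injective)

Var : Set
Var = ℕ

-- Function symbols: ordinary symbols, and the symbols f_κ associated
-- with proof-term constants κ (used by ⟦_⟧ and by F).
data FSym : Set where
  sym : ℕ → FSym
  pf  : ℕ → FSym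

data Term : Set where
  var : Var → Term
  fn  : FSym → List Term → Term

data Atom : Set where
  atom : ℕ → List Term → Atom

_[_] : Atom → Term → Atom
atom P ts [ t ] = atom P (ts ++ (t ∷ []))

mutual
  varsT : Term → List Var
  varsT (var x) = x ∷ []
  varsT (fn f ts) = varsTs ts

  varsTs : List Term → List Var
  varsTs [] = []
  varsTs (t ∷ ts) = varsT t ++ varsTs ts

mutual
  funsT : Term → List FSym
  funsT (var x) = []
  funsT (fn f ts) = f ∷ funsTs ts

  funsTs : List Term → List FSym
  funsTs [] = []
  funsTs (t ∷ ts) = funsT t ++ funsTs ts

varsA : Atom → List Var
varsA (atom P ts) = varsTs ts

varsAs : List Atom → List Var
varsAs [] = []
varsAs (A ∷ As) = varsA A ++ varsAs As

funsA : Atom → List FSym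
funsA (atom P ts) = funsTs ts

funsAs : List Atom → List FSym
funsAs [] = []
funsAs (A ∷ As) = funsA A ++ funsAs As

Subst : Set
Subst = Var → Term

mutual
  subT : Subst → Term → Term
  subT σ (var x) = σ x
  subT σ (fn f ts) = fn f (subTs σ ts)

  subTs : Subst → List Term → List Term
  subTs σ [] = []
  subTs σ (t ∷ ts) = subT σ t ∷ subTs σ ts

subA : Subst → Atom → Atom
subA σ (atom P ts) = atom P (subTs σ ts)

_∘ₛ_ : Subst → Subst → Subst
(θ ∘ₛ γ) x = subT θ (γ x)

-- simultaneous substitution [t̲/x̲] from a list of pairs (first match wins)
lookupSub : List (Var × Term) → Subst
lookupSub [] y = var y
lookupSub ((x , t) ∷ xts) y = if x ≡ᵇ y then t else lookupSub xts y

record Horn : Set where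
  constructor _⇒_
  field
    body : List Atom
    head : Atom
open Horn public

subH : Subst → Horn → Horn
subH σ (As ⇒ B) = map (subA σ) As ⇒ subA σ B

varsH : Horn → List Var
varsH (As ⇒ B) = varsAs As ++ varsA B

data Formula : Set where
  horn : Horn → Formula
  ∀[_]_ : List Var → Horn → Formula

record Axiom : Set where
  constructor ax
  field
    label : ℕ
    bound : List Var
    hclause : Horn
open Axiom public

Program : Set
Program = List Axiom

ClosedAxiom : Axiom → Set
ClosedAxiom (ax κ xs h) = ∀ x → x ∈ varsH h → x ∈ xs

NoReserved : Axiom → Set
NoReserved (ax κ xs (As ⇒ B)) = ∀ k → pf k ∉ (funsAs As ++ funsA B)

LogicProgram : Program → Set
LogicProgram Φ = Unique (map label Φ) × All ClosedAxiom Φ × All NoReserved Φ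

-- Proof terms (de Bruijn indices for proof-term variables)

data PT : Set where
  con : ℕ → PT
  pv  : ℕ → PT
  lam : PT → PT
  _·_ : PT → PT → PT
infixl 9 _·_

shift : ℕ → PT → PT
shift c (con k) = con k
shift c (pv i) = if i <ᵇ c then pv i else pv (suc i)
shift c (lam e) = lam (shift (suc c) e)
shift c (e · e') = shift c e · shift c e'

shiftN : ℕ → PT → PT
shiftN zero e = e
shiftN (suc n) e = shift 0 (shiftN n e)

-- e[j := s] (s given relative to outermost context), lowering vars > j
substPT : ℕ → PT → PT → PT
substPT j s (con k) = con k
substPT j s (pv i) =
  if i <ᵇ j then pv i else (if i ≡ᵇ j then shiftN j s else pv (pred i))
substPT j s (lam e) = lam (substPT (suc j) s e)
substPT j s (e · e') = substPT j s e · substPT j s e'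

data _⟶β_ : PT → PT → Set where
  β    : ∀ {e s} → (lam e · s) ⟶β substPT 0 s e
  ξlam : ∀ {e e'} → e ⟶β e' → lam e ⟶β lam e'
  ξl   : ∀ {e e' s} → e ⟶β e' → (e · s) ⟶β (e' · s)
  ξr   : ∀ {e s s'} → s ⟶β s' → (e · s) ⟶β (e · s')

_≈β_ : PT → PT → Set
_≈β_ = EqClosure _⟶β_

lams : ℕ → PT → PT
lams zero e = e
lams (suc n) e = lam (lams n e)

apps : PT → List PT → PT
apps e [] = e
apps e (a ∷ as) = apps (e · a) as

-- de Bruijn variables pv (k+m-1), …, pv k   (the variables a₁…aₘ when
-- k further binders are inside them)
argVars : ℕ → ℕ → List PT
argVars k zero = []
argVars k (suc m) = pv (k + m) ∷ argVars k m
  where open import Data.Nat using (_+_)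

-- the cut term  λa̲.λb̲.(e₂ b̲)(e₁ a̲)  with |a̲| = m, |b̲| = k
cutTerm : ℕ → ℕ → PT → PT → PT
cutTerm m k e₁ e₂ =
  lams m (lams k (apps (shiftN (m + k) e₂) (argVars 0 k)
                  · apps (shiftN (m + k) e₁) (argVars k m)))
  where open import Data.Nat using (_+_)

data _⊢_∶_ (Ψ : Program) : PT → Formula → Set where
  axiom : ∀ {κ xs h} → ax κ xs h ∈ Ψ → Ψ ⊢ con κ ∶ (∀[ xs ] h)
  gen   : ∀ {e h} xs → Ψ ⊢ e ∶ horn h → Ψ ⊢ e ∶ (∀[ xs ] h)
  inst  : ∀ {e xs h} (xts : List (Var × Term)) → map proj₁ xts ≡ xs →
          Ψ ⊢ e ∶ (∀[ xs ] h) → Ψ ⊢ e ∶ horn (subH (lookupSub xts) h)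
  cut   : ∀ {e₁ e₂ As Bs D C} →
          Ψ ⊢ e₁ ∶ horn (As ⇒ D) →
          Ψ ⊢ e₂ ∶ horn ((Bs ++ (D ∷ [])) ⇒ C) →
          Ψ ⊢ cutTerm (length As) (length Bs) e₁ e₂ ∶ horn ((As ++ Bs) ⇒ C)

Derivable : Program → PT → Formula → Set
Derivable Ψ e F = ∃[ e' ] (Ψ ⊢ e' ∶ F × e' ≈β e)

data FOPT : Set where
  node : ℕ → List FOPT → FOPT

mutual
  embed : FOPT → PT
  embed (node κ ps) = apps (con κ) (embeds ps)

  embeds : List FOPT → List PT
  embeds [] = []
  embeds (p ∷ ps) = embed p ∷ embeds ps

mutual
  ⟦_⟧∅ : FOPT → Term
  ⟦ node κ ps ⟧∅ = fn (pf κ) (⟦ ps ⟧s)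

  ⟦_⟧s : List FOPT → List Term
  ⟦ [] ⟧s = []
  ⟦ p ∷ ps ⟧s = ⟦ p ⟧∅ ∷ ⟦ ps ⟧s

-- The transformation F(Φ), as a relation (the fresh variables y̲ are
-- arbitrary distinct variables not occurring in the axiom)

data FAxiom : Axiom → Axiom → Set where
  mkF : ∀ {κ xs As B} (ys : List Var) →
        Unique ys → length ys ≡ length As →
        (∀ y → y ∈ ys → y ∉ xs × y ∉ varsH (As ⇒ B)) →
        FAxiom (ax κ xs (As ⇒ B))
               (ax κ (xs ++ ys)
                   (zipWith _[_] As (map var ys) ⇒ (B [ fn (pf κ) (map var ys) ])))

IsF : Program → Program → Set
IsF Φ Φ' = Pointwise FAxiom Φ Φ'

Unifier : Subst → Atom → Atom → Set
Unifier γ A B = subA γ A ≡ subA γ B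

MGU : Subst → Atom → Atom → Set
MGU γ A B = Unifier γ A B ×
  (∀ δ → Unifier δ A B → ∃[ θ ] (∀ x → δ x ≡ (θ ∘ₛ γ) x))

renSub : (Var → Var) → Subst
renSub ρ x = var (ρ x)

data LPStep (Ψ : Program) : List Atom → List Atom → Set where
  step : ∀ {κ xs Bs C} (G₁ : List Atom) (Ai : Atom) (G₂ : List Atom)
         (ρ : Var → Var) (γ : Subst) →
         ax κ xs (Bs ⇒ C) ∈ Ψ →
         Injective _≡_ _≡_ ρ →
         (∀ x → x ∈ varsH (Bs ⇒ C) → ρ x ∉ varsAs (G₁ ++ Ai ∷ G₂)) →
         MGU γ (subA (renSub ρ) C) Ai →
         LPStep Ψ (G₁ ++ Ai ∷ G₂)
                  (map (subA γ) G₁ ++ map (subA (γ ∘ₛ renSub ρ)) Bs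
                                   ++ map (subA γ) G₂)

_⊢_↝*_ : Program → List Atom → List Atom → Set
Ψ ⊢ G ↝* G' = Star (LPStep Ψ) G G'

-- Typing is sound for proofs by clause application: if  e : A₁,…,Aₘ ⇒ B  is
-- derivable, then every instance of B whose matching body instances have
-- such proofs has one as well.  So a derivation of  n : ⇒ A[⟦n⟧]  yields a
-- proof of the goal.  Conversely, LP-Unif is complete (the lifting lemma):
-- if an instance σG of a goal G is proved, rename the clause used at the
-- first atom of G apart from G, combine σ with the clause instance into a
-- unifier, and resolve with a most general unifier, which exists by
-- Robinson's algorithm; the resolvent then has an instance with a strictly
-- smaller proof.
module Submission where

open import Defs hiding (sym)
open import Data.Nat using (ℕ; zero; suc; _+_; _∸_; _≤_; _<_; s≤s; _≟_)
open import Data.Nat.Properties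
open import Data.Nat.Induction using (<-wellFounded)
open import Induction.WellFounded using (Acc; acc)
open import Data.List using (List; []; _∷_; _++_; map; length; filter)
open import Data.List.Properties using (∷-injective; ∷-injectiveˡ; ∷-injectiveʳ; ++-assoc; map-++; filter-notAll)
open import Data.List.Extrema.Nat using (max; xs≤max)
open import Data.List.Membership.Propositional using (_∈_; _∉_)
open import Data.List.Membership.Propositional.Properties using (∈-++⁺ˡ; ∈-++⁺ʳ; ∈-++⁻; ∈-filter⁺)
open import Data.List.Membership.DecPropositional _≟_ using (_∈?_)
open import Data.List.Relation.Binary.Subset.Propositional using (_⊆_)
open import Data.List.Relation.Binary.Subset.Propositional.Properties using (xs⊆xs++ys; xs⊆ys++xs)
open import Data.List.Relation.Unary.Any as Any using (here; there)
open import Data.List.Relation.Unary.All as All using ()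
open import Data.Product using (∃₂; ∃-syntax; _×_; _,_; proj₁; proj₂; map₂)
open import Data.Sum using (inj₁; inj₂)
open import Data.Empty using (⊥-elim)
open import Relation.Nullary using (yes; no; ¬?)
open import Relation.Binary.PropositionalEquality using (_≡_; _≢_; refl; sym; trans; cong; cong₂; subst; module ≡-Reasoning)
open import Relation.Binary.Construct.Closure.ReflexiveTransitive using (ε; _◅_)

open ≡-Reasoning

mutual
  subT-cong : ∀ {σ τ} t → (∀ x → x ∈ varsT t → σ x ≡ τ x) → subT σ t ≡ subT τ t
  subT-cong (var x) σ≈τ = σ≈τ x (here refl)
  subT-cong (fn f ts) σ≈τ = cong (fn f) (subTs-cong ts σ≈τ)

  subTs-cong : ∀ {σ τ} ts → (∀ x → x ∈ varsTs ts → σ x ≡ τ x) → subTs σ ts ≡ subTs τ ts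
  subTs-cong [] σ≈τ = refl
  subTs-cong (t ∷ ts) σ≈τ =
    cong₂ _∷_ (subT-cong t (λ x x∈t → σ≈τ x (∈-++⁺ˡ x∈t)))
              (subTs-cong ts (λ x x∈ts → σ≈τ x (∈-++⁺ʳ (varsT t) x∈ts)))

mutual
  subT-∘ : ∀ σ τ t → subT (σ ∘ₛ τ) t ≡ subT σ (subT τ t)
  subT-∘ σ τ (var x) = refl
  subT-∘ σ τ (fn f ts) = cong (fn f) (subTs-∘ σ τ ts)

  subTs-∘ : ∀ σ τ ts → subTs (σ ∘ₛ τ) ts ≡ subTs σ (subTs τ ts)
  subTs-∘ σ τ [] = refl
  subTs-∘ σ τ (t ∷ ts) = cong₂ _∷_ (subT-∘ σ τ t) (subTs-∘ σ τ ts)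

mutual
  subT-id : ∀ t → subT var t ≡ t
  subT-id (var x) = refl
  subT-id (fn f ts) = cong (fn f) (subTs-id ts)

  subTs-id : ∀ ts → subTs var ts ≡ ts
  subTs-id [] = refl
  subTs-id (t ∷ ts) = cong₂ _∷_ (subT-id t) (subTs-id ts)

mutual
  ∈-varsT-subT : ∀ σ t {y} → y ∈ varsT (subT σ t) → ∃[ z ] (z ∈ varsT t × y ∈ varsT (σ z))
  ∈-varsT-subT σ (var x) y∈ = x , here refl , y∈
  ∈-varsT-subT σ (fn f ts) y∈ = ∈-varsTs-subTs σ ts y∈

  ∈-varsTs-subTs : ∀ σ ts {y} → y ∈ varsTs (subTs σ ts) → ∃[ z ] (z ∈ varsTs ts × y ∈ varsT (σ z))
  ∈-varsTs-subTs σ (t ∷ ts) y∈ with ∈-++⁻ (varsT (subT σ t)) y∈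
  ... | inj₁ y∈t  = map₂ (λ (z∈ , y∈σz) → ∈-++⁺ˡ z∈ , y∈σz) (∈-varsT-subT σ t y∈t)
  ... | inj₂ y∈ts = map₂ (λ (z∈ , y∈σz) → ∈-++⁺ʳ (varsT t) z∈ , y∈σz) (∈-varsTs-subTs σ ts y∈ts)

subTs-++ : ∀ σ ts us → subTs σ (ts ++ us) ≡ subTs σ ts ++ subTs σ us
subTs-++ σ [] us = refl
subTs-++ σ (t ∷ ts) us = cong (subT σ t ∷_) (subTs-++ σ ts us)

length-subTs : ∀ σ ts → length (subTs σ ts) ≡ length ts
length-subTs σ [] = refl
length-subTs σ (t ∷ ts) = cong suc (length-subTs σ ts)

varsTs-++ : ∀ ts us → varsTs (ts ++ us) ≡ varsTs ts ++ varsTs us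
varsTs-++ [] us = refl
varsTs-++ (t ∷ ts) us =
  trans (cong (varsT t ++_) (varsTs-++ ts us)) (sym (++-assoc (varsT t) (varsTs ts) (varsTs us)))

fn-injective : ∀ {f g ts us} → fn f ts ≡ fn g us → f ≡ g × ts ≡ us
fn-injective refl = refl , refl

atom-injective : ∀ {P Q ts us} → atom P ts ≡ atom Q us → P ≡ Q × ts ≡ us
atom-injective refl = refl , refl

++-injective : ∀ {A : Set} (ws xs : List A) {ys zs} →
               length ws ≡ length xs → ws ++ ys ≡ xs ++ zs → ws ≡ xs × ys ≡ zs
++-injective [] [] _ eq = refl , eq
++-injective (w ∷ ws) (x ∷ xs) len eq with ∷-injective eq
... | refl , eq′ with ++-injective ws xs (suc-injective len) eq′
...   | refl , ys≡zs = refl , ys≡zs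

mutual
  sizeT : Term → ℕ
  sizeT (var x) = 1
  sizeT (fn f ts) = suc (sizeTs ts)

  sizeTs : List Term → ℕ
  sizeTs [] = 0
  sizeTs (t ∷ ts) = sizeT t + sizeTs ts

sizeTs-++ : ∀ ts us → sizeTs (ts ++ us) ≡ sizeTs ts + sizeTs us
sizeTs-++ [] us = refl
sizeTs-++ (t ∷ ts) us = trans (cong (sizeT t +_) (sizeTs-++ ts us)) (sym (+-assoc (sizeT t) _ _))

mutual
  sizeT-≤-subT : ∀ σ {x} t → x ∈ varsT t → sizeT (σ x) ≤ sizeT (subT σ t)
  sizeT-≤-subT σ (var x) (here refl) = ≤-refl
  sizeT-≤-subT σ (fn f ts) x∈ = m≤n⇒m≤1+n (sizeT-≤-subTs σ ts x∈)

  sizeT-≤-subTs : ∀ σ {x} ts → x ∈ varsTs ts → sizeT (σ x) ≤ sizeTs (subTs σ ts)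
  sizeT-≤-subTs σ (t ∷ ts) x∈ with ∈-++⁻ (varsT t) x∈
  ... | inj₁ x∈t  = ≤-trans (sizeT-≤-subT σ t x∈t) (m≤m+n _ _)
  ... | inj₂ x∈ts = ≤-trans (sizeT-≤-subTs σ ts x∈ts) (m≤n+m _ _)

occurs-check : ∀ δ {x} f us → x ∈ varsTs us → δ x ≢ subT δ (fn f us)
occurs-check δ f us x∈us eq =
  <-irrefl refl (≤-trans (s≤s (sizeT-≤-subTs δ us x∈us)) (≤-reflexive (sym (cong sizeT eq))))

_↦_ : Var → Term → Subst
(x ↦ t) y with x ≟ y
... | yes _ = t
... | no _  = var y

↦-self : ∀ x t → (x ↦ t) x ≡ t
↦-self x t with x ≟ x
... | yes _ = refl
... | no x≢x = ⊥-elim (x≢x refl)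

↦-fresh : ∀ {x} t u → x ∉ varsT u → subT (x ↦ t) u ≡ u
↦-fresh {x} t u x∉u = trans (subT-cong u other) (subT-id u)
  where
    other : ∀ y → y ∈ varsT u → (x ↦ t) y ≡ var y
    other y y∈u with x ≟ y
    ... | yes refl = ⊥-elim (x∉u y∈u)
    ... | no _     = refl

↦-absorb : ∀ δ {x t} → δ x ≡ subT δ t → ∀ y → subT δ ((x ↦ t) y) ≡ δ y
↦-absorb δ {x} δx≡δt y with x ≟ y
... | yes refl = sym δx≡δt
... | no _     = refl

remove : Var → List Var → List Var
remove x = filter (λ y → ¬? (y ≟ x))

length-remove : ∀ {x V} → x ∈ V → length (remove x V) < length V
length-remove {x} {V} x∈V =
  filter-notAll (λ y → ¬? (y ≟ x)) V (Any.map (λ x≡y y≢x → y≢x (sym x≡y)) x∈V)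

varsTs-↦ : ∀ {V x t} ts → x ∉ varsT t → varsT t ⊆ V → varsTs ts ⊆ V →
           varsTs (subTs (x ↦ t) ts) ⊆ remove x V
varsTs-↦ {x = x} {t} ts x∉t t⊆V ts⊆V {y} y∈ with ∈-varsTs-subTs (x ↦ t) ts y∈
... | z , z∈ts , y∈ with x ≟ z
...   | yes refl = ∈-filter⁺ (λ y → ¬? (y ≟ x)) (t⊆V y∈) (λ { refl → x∉t y∈ })
...   | no x≢z with y∈
...     | here refl = ∈-filter⁺ (λ y → ¬? (y ≟ x)) (ts⊆V z∈ts) (λ z≡x → x≢z (sym z≡x))

Unifies : List Term → List Term → Subst → Set
Unifies ls rs δ = subTs δ ls ≡ subTs δ rs

-- MGU γ A B is definitionally IsMGU (λ δ → Unifier δ A B) γ.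
IsMGU : (Subst → Set) → Subst → Set
IsMGU P γ = P γ × (∀ δ → P δ → ∃[ θ ] (∀ x → δ x ≡ (θ ∘ₛ γ) x))

HasMGU : List Term → List Term → Set
HasMGU ls rs = ∃[ γ ] IsMGU (Unifies ls rs) γ

IsMGU-resp : ∀ {P Q : Subst → Set} {γ} → (∀ {δ} → P δ → Q δ) → (∀ {δ} → Q δ → P δ) →
             IsMGU P γ → IsMGU Q γ
IsMGU-resp P⇒Q Q⇒P (Pγ , general) = P⇒Q Pγ , λ δ Qδ → general δ (Q⇒P Qδ)

Unifies-++ : ∀ {δ} ts us ls rs → Unifies ts us δ → Unifies ls rs δ → Unifies (ts ++ ls) (us ++ rs) δ
Unifies-++ {δ} ts us ls rs ts≈us ls≈rs =
  trans (subTs-++ δ ts ls) (trans (cong₂ _++_ ts≈us ls≈rs) (sym (subTs-++ δ us rs)))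

Unifies-++⁻ : ∀ {δ} ts us ls rs → length ts ≡ length us →
              Unifies (ts ++ ls) (us ++ rs) δ → Unifies ts us δ × Unifies ls rs δ
Unifies-++⁻ {δ} ts us ls rs len eq =
  ++-injective (subTs δ ts) (subTs δ us)
    (trans (length-subTs δ ts) (trans len (sym (length-subTs δ us))))
    (trans (sym (subTs-++ δ ts ls)) (trans eq (subTs-++ δ us rs)))

Unifies-decompose : ∀ {δ f} ts us ls rs →
                    Unifies (fn f ts ∷ ls) (fn f us ∷ rs) δ → Unifies (ts ++ ls) (us ++ rs) δ
Unifies-decompose ts us ls rs eq with ∷-injective eq
... | fts≈fus , ls≈rs = Unifies-++ ts us ls rs (proj₂ (fn-injective fts≈fus)) ls≈rs

Unifies-compose : ∀ {δ f} ts us ls rs → length ts ≡ length us →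
                  Unifies (ts ++ ls) (us ++ rs) δ → Unifies (fn f ts ∷ ls) (fn f us ∷ rs) δ
Unifies-compose ts us ls rs len eq with Unifies-++⁻ ts us ls rs len eq
... | ts≈us , ls≈rs = cong₂ _∷_ (cong (fn _) ts≈us) ls≈rs

Unifies-eliminate : ∀ {δ x t} ls rs → δ x ≡ subT δ t → Unifies ls rs δ →
                    Unifies (subTs (x ↦ t) ls) (subTs (x ↦ t) rs) δ
Unifies-eliminate {δ} {x} {t} ls rs δx≡δt ls≈rs = begin
  subTs δ (subTs (x ↦ t) ls)  ≡⟨ absorb ls ⟩
  subTs δ ls                  ≡⟨ ls≈rs ⟩
  subTs δ rs                  ≡⟨ absorb rs ⟨
  subTs δ (subTs (x ↦ t) rs)  ∎
  where
    absorb : ∀ ts → subTs δ (subTs (x ↦ t) ts) ≡ subTs δ ts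
    absorb ts = trans (sym (subTs-∘ δ (x ↦ t) ts)) (subTs-cong ts (λ y _ → ↦-absorb δ δx≡δt y))

IsMGU-eliminate : ∀ {x t γ} ls rs → x ∉ varsT t →
                  IsMGU (Unifies (subTs (x ↦ t) ls) (subTs (x ↦ t) rs)) γ →
                  IsMGU (Unifies (var x ∷ ls) (t ∷ rs)) (γ ∘ₛ (x ↦ t))
IsMGU-eliminate {x} {t} {γ} ls rs x∉t (γ-unifies , γ-general) = cong₂ _∷_ heads tails , general
  where
    heads : subT γ ((x ↦ t) x) ≡ subT (γ ∘ₛ (x ↦ t)) t
    heads = begin
      subT γ ((x ↦ t) x)         ≡⟨ cong (subT γ) (↦-self x t) ⟩
      subT γ t                   ≡⟨ cong (subT γ) (↦-fresh t t x∉t) ⟨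
      subT γ (subT (x ↦ t) t)    ≡⟨ subT-∘ γ (x ↦ t) t ⟨
      subT (γ ∘ₛ (x ↦ t)) t      ∎
    tails : Unifies ls rs (γ ∘ₛ (x ↦ t))
    tails = trans (subTs-∘ γ (x ↦ t) ls) (trans γ-unifies (sym (subTs-∘ γ (x ↦ t) rs)))
    general : ∀ δ → Unifies (var x ∷ ls) (t ∷ rs) δ → ∃[ θ ] (∀ y → δ y ≡ (θ ∘ₛ (γ ∘ₛ (x ↦ t))) y)
    general δ eq with ∷-injective eq
    ... | δx≡δt , ls≈rs with γ-general δ (Unifies-eliminate ls rs δx≡δt ls≈rs)
    ...   | θ , δ≈θγ = θ , λ y → begin
      δ y                              ≡⟨ ↦-absorb δ δx≡δt y ⟨
      subT δ ((x ↦ t) y)               ≡⟨ subT-cong ((x ↦ t) y) (λ z _ → δ≈θγ z) ⟩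
      subT (θ ∘ₛ γ) ((x ↦ t) y)        ≡⟨ subT-∘ θ γ ((x ↦ t) y) ⟩
      subT θ (subT γ ((x ↦ t) y))      ∎

-- Robinson's algorithm on the system ls ≐ rs, whose variables lie in V:
-- elimination shrinks V, the other steps shrink the system.
mutual
  unify : (V : List Var) (ls rs : List Term) → varsTs ls ⊆ V → varsTs rs ⊆ V →
          Acc _<_ (length V) → Acc _<_ (sizeTs ls + sizeTs rs) →
          ∀ δ → Unifies ls rs δ → HasMGU ls rs
  unify V [] [] _ _ _ _ _ _ = var , refl , λ δ _ → δ , λ _ → refl
  unify V (var x ∷ ls) (t ∷ rs) ls⊆V rs⊆V accV accS δ eq with x ∈? varsT t
  ... | no x∉t = eliminate V x t ls rs x∉t ls⊆V rs⊆V accV δ eq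
  unify V (var x ∷ ls) (var .x ∷ rs) ls⊆V rs⊆V accV (acc smaller) δ eq | yes (here refl) =
    map₂ (IsMGU-resp (cong (_ ∷_)) ∷-injectiveʳ)
      (unify V ls rs (λ y∈ → ls⊆V (there y∈)) (λ y∈ → rs⊆V (there y∈)) accV
             (smaller (+-mono-< (n<1+n _) (n<1+n _))) δ (∷-injectiveʳ eq))
  unify V (var x ∷ ls) (fn g us ∷ rs) _ _ _ _ δ eq | yes x∈us =
    ⊥-elim (occurs-check δ g us x∈us (∷-injectiveˡ eq))
  unify V (fn f ts ∷ ls) (var x ∷ rs) ls⊆V rs⊆V accV _ δ eq with x ∈? varsTs ts
  ... | yes x∈ts = ⊥-elim (occurs-check δ f ts x∈ts (sym (∷-injectiveˡ eq)))
  ... | no x∉ts =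
    map₂ (IsMGU-resp sym sym) (eliminate V x (fn f ts) rs ls x∉ts rs⊆V ls⊆V accV δ (sym eq))
  unify V (fn f ts ∷ ls) (fn g us ∷ rs) ls⊆V rs⊆V accV (acc smaller) δ eq
    with fn-injective (∷-injectiveˡ eq)
  ... | refl , ts≈us =
    map₂ (IsMGU-resp (Unifies-compose ts us ls rs len) (Unifies-decompose ts us ls rs))
      (unify V (ts ++ ls) (us ++ rs)
             (subst (_⊆ V) (sym (varsTs-++ ts ls)) ls⊆V) (subst (_⊆ V) (sym (varsTs-++ us rs)) rs⊆V)
             accV (smaller shrinks) δ (Unifies-decompose ts us ls rs eq))
    where
      len : length ts ≡ length us
      len = trans (sym (length-subTs δ ts)) (trans (cong length ts≈us) (length-subTs δ us))
      shrinks : sizeTs (ts ++ ls) + sizeTs (us ++ rs) < sizeTs (fn f ts ∷ ls) + sizeTs (fn f us ∷ rs)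
      shrinks = subst (_< sizeTs (fn f ts ∷ ls) + sizeTs (fn f us ∷ rs))
                      (sym (cong₂ _+_ (sizeTs-++ ts ls) (sizeTs-++ us rs)))
                      (+-mono-< (n<1+n (sizeTs ts + sizeTs ls)) (n<1+n (sizeTs us + sizeTs rs)))

  eliminate : (V : List Var) (x : Var) (t : Term) (ls rs : List Term) → x ∉ varsT t →
              varsTs (var x ∷ ls) ⊆ V → varsTs (t ∷ rs) ⊆ V → Acc _<_ (length V) →
              ∀ δ → Unifies (var x ∷ ls) (t ∷ rs) δ → HasMGU (var x ∷ ls) (t ∷ rs)
  eliminate V x t ls rs x∉t xls⊆V trs⊆V (acc fewer) δ eq with ∷-injective eq
  ... | δx≡δt , ls≈rs
    with unify (remove x V) (subTs (x ↦ t) ls) (subTs (x ↦ t) rs)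
               (varsTs-↦ ls x∉t (λ y∈ → trs⊆V (∈-++⁺ˡ y∈)) (λ y∈ → xls⊆V (there y∈)))
               (varsTs-↦ rs x∉t (λ y∈ → trs⊆V (∈-++⁺ˡ y∈)) (λ y∈ → trs⊆V (∈-++⁺ʳ (varsT t) y∈)))
               (fewer (length-remove (xls⊆V (here refl)))) (<-wellFounded _)
               δ (Unifies-eliminate ls rs δx≡δt ls≈rs)
  ... | γ , γ-mgu = γ ∘ₛ (x ↦ t) , IsMGU-eliminate ls rs x∉t γ-mgu

unifiable⇒mgu : ∀ A B δ → Unifier δ A B → ∃[ γ ] MGU γ A B
unifiable⇒mgu (atom P ts) (atom Q us) δ eq with atom-injective eq
... | refl , ts≈us =
  map₂ (IsMGU-resp (cong (atom P)) (λ eq′ → proj₂ (atom-injective eq′)))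
    (unify (varsTs ts ++ varsTs us) ts us (xs⊆xs++ys _ _) (xs⊆ys++xs _ _)
           (<-wellFounded _) (<-wellFounded _) δ ts≈us)

subA-cong : ∀ {σ τ} A → (∀ x → x ∈ varsA A → σ x ≡ τ x) → subA σ A ≡ subA τ A
subA-cong (atom P ts) σ≈τ = cong (atom P) (subTs-cong ts σ≈τ)

subA-∘ : ∀ σ τ A → subA (σ ∘ₛ τ) A ≡ subA σ (subA τ A)
subA-∘ σ τ (atom P ts) = cong (atom P) (subTs-∘ σ τ ts)

map-subA-cong : ∀ {σ τ} As → (∀ x → x ∈ varsAs As → σ x ≡ τ x) → map (subA σ) As ≡ map (subA τ) As
map-subA-cong [] σ≈τ = refl
map-subA-cong (A ∷ As) σ≈τ =
  cong₂ _∷_ (subA-cong A (λ x x∈A → σ≈τ x (∈-++⁺ˡ x∈A)))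
            (map-subA-cong As (λ x x∈As → σ≈τ x (∈-++⁺ʳ (varsA A) x∈As)))

map-subA-∘ : ∀ σ τ As → map (subA (σ ∘ₛ τ)) As ≡ map (subA σ) (map (subA τ) As)
map-subA-∘ σ τ [] = refl
map-subA-∘ σ τ (A ∷ As) = cong₂ _∷_ (subA-∘ σ τ A) (map-subA-∘ σ τ As)

-- Proof trees of a list of atoms, flattened so that a node also carries the
-- proofs of its right siblings; the index counts clause applications.
data Proof (Ψ : Program) : ℕ → List Atom → Set where
  []   : Proof Ψ 0 []
  node : ∀ {κ xs Bs C A As m n} → ax κ xs (Bs ⇒ C) ∈ Ψ → (θ : Subst) → A ≡ subA θ C →
         Proof Ψ m (map (subA θ) Bs) → Proof Ψ n As → Proof Ψ (suc (m + n)) (A ∷ As)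

_++ᴾ_ : ∀ {Ψ m n As Bs} → Proof Ψ m As → Proof Ψ n Bs → Proof Ψ (m + n) (As ++ Bs)
[] ++ᴾ q = q
_++ᴾ_ {Ψ} {n = n} {Bs = Bs} (node {A = A} {As = As} {m = i} {n = j} mem θ eq p ps) q =
  subst (λ k → Proof Ψ (suc k) (A ∷ As ++ Bs)) (sym (+-assoc i j n)) (node mem θ eq p (ps ++ᴾ q))

Provable : Program → List Atom → Set
Provable Ψ As = ∃[ n ] Proof Ψ n As

Provable-++ : ∀ {Ψ As Bs} → Provable Ψ As → Provable Ψ Bs → Provable Ψ (As ++ Bs)
Provable-++ (_ , p) (_ , q) = _ , p ++ᴾ q

Provable-++⁻ : ∀ {Ψ} As {Bs} → Provable Ψ (As ++ Bs) → Provable Ψ As × Provable Ψ Bs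
Provable-++⁻ [] p = (0 , []) , p
Provable-++⁻ (A ∷ As) (_ , node mem θ eq p ps) with Provable-++⁻ As (_ , ps)
... | (_ , ps₁) , ps₂ = (_ , node mem θ eq p ps₁) , ps₂

Valid : Program → Horn → Set
Valid Ψ (As ⇒ C) = ∀ σ → Provable Ψ (map (subA σ) As) → Provable Ψ (subA σ C ∷ [])

-- A quantified formula means the same as its matrix: Valid already ranges over all instances.
ValidF : Program → Formula → Set
ValidF Ψ (horn h) = Valid Ψ h
ValidF Ψ (∀[ xs ] h) = Valid Ψ h

⊢-sound : ∀ {Ψ e F} → Ψ ⊢ e ∶ F → ValidF Ψ F
⊢-sound (axiom mem) σ (_ , p) = _ , node mem σ refl p []
⊢-sound (gen _ d) = ⊢-sound d
⊢-sound {Ψ} (inst {h = As ⇒ C} xts _ d) σ p =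
  subst (λ A → Provable Ψ (A ∷ [])) (subA-∘ σ (lookupSub xts) C)
    (⊢-sound d (σ ∘ₛ lookupSub xts) (subst (Provable Ψ) (sym (map-subA-∘ σ (lookupSub xts) As)) p))
⊢-sound {Ψ} (cut {As = As} {Bs} {D} d₁ d₂) σ p
  with Provable-++⁻ (map (subA σ) As) (subst (Provable Ψ) (map-++ (subA σ) As Bs) p)
... | pAs , pBs =
  ⊢-sound d₂ σ (subst (Provable Ψ) (sym (map-++ (subA σ) Bs (D ∷ [])))
                      (Provable-++ pBs (⊢-sound d₁ σ pAs)))

splice : ℕ → Subst → Subst → Subst
splice N σ θ z with z <? N
... | yes _ = σ z
... | no _  = θ (z ∸ N)

splice-< : ∀ {N} σ θ {z} → z < N → splice N σ θ z ≡ σ z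
splice-< {N} σ θ {z} z<N with z <? N
... | yes _   = refl
... | no z≮N = ⊥-elim (z≮N z<N)

splice-+ : ∀ N σ θ x → splice N σ θ (x + N) ≡ θ x
splice-+ N σ θ x with x + N <? N
... | yes x+N<N = ⊥-elim (<-irrefl refl (<-≤-trans x+N<N (m≤n+m N x)))
... | no _      = cong θ (m+n∸n≡m x N)

lifting : ∀ {Ψ κ xs Bs C m n} A G σ → ax κ xs (Bs ⇒ C) ∈ Ψ → (θ : Subst) → subA σ A ≡ subA θ C →
          Proof Ψ m (map (subA θ) Bs) → Proof Ψ n (map (subA σ) G) →
          ∃₂ λ G′ σ′ → LPStep Ψ (A ∷ G) G′ × Proof Ψ (m + n) (map (subA σ′) G′)
lifting {Ψ} {Bs = Bs} {C} A G σ mem θ σA≡θC pBs pG =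
  _ , θ′ , step [] A G ρ γ mem (λ {x} {y} → +-cancelʳ-≡ N x y) apart γ-mgu ,
  subst (Proof Ψ _) instances (pBs ++ᴾ pG)
  where
    N : ℕ
    N = suc (max 0 (varsAs (A ∷ G)))
    below-N : ∀ {y} → y ∈ varsAs (A ∷ G) → y < N
    below-N y∈ = s≤s (All.lookup (xs≤max 0 (varsAs (A ∷ G))) y∈)
    ρ : Var → Var
    ρ x = x + N
    apart : ∀ x → x ∈ varsH (Bs ⇒ C) → ρ x ∉ varsAs (A ∷ G)
    apart x _ ρx∈ = <-irrefl refl (<-≤-trans (below-N ρx∈) (m≤n+m N x))
    δ : Subst
    δ = splice N σ θ
    δ-unifies : Unifier δ (subA (renSub ρ) C) A
    δ-unifies = begin
      subA δ (subA (renSub ρ) C)  ≡⟨ subA-∘ δ (renSub ρ) C ⟨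
      subA (δ ∘ₛ renSub ρ) C      ≡⟨ subA-cong C (λ x _ → splice-+ N σ θ x) ⟩
      subA θ C                    ≡⟨ σA≡θC ⟨
      subA σ A                    ≡⟨ subA-cong A (λ y y∈ → splice-< σ θ (below-N (∈-++⁺ˡ y∈))) ⟨
      subA δ A                    ∎
    γ : Subst
    γ = proj₁ (unifiable⇒mgu _ A δ δ-unifies)
    γ-mgu : MGU γ (subA (renSub ρ) C) A
    γ-mgu = proj₂ (unifiable⇒mgu _ A δ δ-unifies)
    θ′ : Subst
    θ′ = proj₁ (proj₂ γ-mgu δ δ-unifies)
    δ≈θ′γ : ∀ x → δ x ≡ (θ′ ∘ₛ γ) x
    δ≈θ′γ = proj₂ (proj₂ γ-mgu δ δ-unifies)
    instances : map (subA θ) Bs ++ map (subA σ) G ≡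
                map (subA θ′) (map (subA (γ ∘ₛ renSub ρ)) Bs ++ map (subA γ) G)
    instances = sym (begin
      map (subA θ′) (map (subA (γ ∘ₛ renSub ρ)) Bs ++ map (subA γ) G)
        ≡⟨ map-++ (subA θ′) (map (subA (γ ∘ₛ renSub ρ)) Bs) (map (subA γ) G) ⟩
      map (subA θ′) (map (subA (γ ∘ₛ renSub ρ)) Bs) ++ map (subA θ′) (map (subA γ) G)
        ≡⟨ cong₂ _++_ (map-subA-∘ θ′ _ Bs) (map-subA-∘ θ′ γ G) ⟨
      map (subA (θ′ ∘ₛ (γ ∘ₛ renSub ρ))) Bs ++ map (subA (θ′ ∘ₛ γ)) G
        ≡⟨ cong₂ _++_ (map-subA-cong Bs (λ x _ → trans (sym (δ≈θ′γ (ρ x))) (splice-+ N σ θ x)))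
                      (map-subA-cong G (λ x _ → sym (δ≈θ′γ x))) ⟩
      map (subA θ) Bs ++ map (subA δ) G
        ≡⟨ cong (map (subA θ) Bs ++_)
                (map-subA-cong G (λ y y∈ → splice-< σ θ (below-N (∈-++⁺ʳ (varsA A) y∈)))) ⟩
      map (subA θ) Bs ++ map (subA σ) G  ∎)

refutation : ∀ {Ψ} n G σ → Proof Ψ n (map (subA σ) G) → Ψ ⊢ G ↝* []
refutation zero [] σ [] = ε
refutation (suc n) (A ∷ G) σ (node mem θ σA≡θC pBs pG) =
  let G′ , σ′ , s , p = lifting A G σ mem θ σA≡θC pBs pG in s ◅ refutation n G′ σ′ p

lemma4 : (Φ Φ' : Program) → LogicProgram Φ → IsF Φ Φ' →
         (n : FOPT) (A : Atom) →
         Derivable Φ' (embed n) (horn ([] ⇒ (A [ ⟦ n ⟧∅ ]))) →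
         Φ' ⊢ ((A [ ⟦ n ⟧∅ ]) ∷ []) ↝* []
lemma4 _ _ _ _ n A (_ , d , _) with ⊢-sound d var (0 , [])
... | k , p = refutation k ((A [ ⟦ n ⟧∅ ]) ∷ []) var p
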